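{- Let $\mathcal{T}$ be a first-order theory, $\varphi_{\mathcal{T}}(\overline{x},\overline{y})$ a safety $\mathrm{LTL}_{\mathcal{T}}$ specification with Boolean abstraction $\varphi_{\mathbb{B}}$. Let $C_1$ be the shield obtained from a winning Boolean controller $C_{\mathbb{B}}$ for $\varphi_{\mathbb{B}}$, and $C_2$ the shield obtained from the winning region of $\varphi_{\mathbb{B}}$. Let $D$ be an external controller. If $\pi$ is a trace obtained by $D\cdot C_1$ for some input sequence $\pi_{\overline{x}}$, then $\pi$ is a trace of $(D\cdot C_1)\cdot C_2$ for $\pi_{\overline{x}}$.
   Context: $\mathrm{LTL}_{\mathcal{T}}$ is LTL with literals $l_1,\dots,l_n$ of $\mathcal{T}$ as atoms; environment controls $\overline{x}$, system controls $\overline{y}$. Boolean abstraction: fresh system propositions $s_i$ for $l_i$; a choice $c\subseteq\{s_1,\dots,s_n\}$ (identified with a valuation of $\overline{s}$) has $f_c=\bigwedge_{s_i\in c}l_i\wedge\bigwedge_{s_i\notin c}\neg l_i$; a reaction $r$ (set of choices) has $f_r(\overline{x})=\bigwedge_{c\in r}\exists\overline{y}.f_c\wedge\bigwedge_{c\notin r}\forall\overline{y}.\neg f_c$, valid if $\exists\overline{x}.f_r$ holds; each input satisfies $f_r$ for exactly one valid $r$, and the partitioner maps $v_{\overline{x}}$ to the Boolean input with only $e_r$ true. $\varphi_{\mathbb{B}}=\varphi_{\mathcal{T}}[l_i\leftarrow s_i]\wedge\square(\varphi^{legal}\rightarrow\bigwedge_r(e_r\rightarrow\bigvee_{c\in r}(\bigwedge_{s_i\in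 c}s_i\wedge\bigwedge_{s_i\notin c}\neg s_i)))$, $\varphi^{legal}$ saying exactly one $e_r$ holds. Shield from a controller $C_{\mathbb{B}}=\langle Q,q_0,\delta,o\rangle$: given $v_{\overline{x}}$ and proposed $v_{\overline{y}}$, with $r$ the reaction of $v_{\overline{x}}$ and $c$ the choice $o(q,v_{\overline{e}})$ in current state $q$ (then moving to $\delta(q,v_{\overline{e}})$), output $v_{\overline{y}}$ if $f_r(v_{\overline{x}})\rightarrow f_c(v_{\overline{x}},v_{\overline{y}})$ holds, else some $v_{\overline{y}}'$ satisfying $f_r(v_{\overline{x}})\rightarrow f_c(v_{\overline{x}},v_{\overline{y}}')$. Winning region $\langle Q,I,T\rangle$ with $T:Q\times\mathrm{val}(\overline{e})\to2^{Q\times\mathrm{val}(\overline{s})}$ giving all winning (successor, output) pairs; every winning strategy for $\varphi_{\mathbb{B}}$ embeds into it. Shield from it: maintain $Q_{now}$ (initially $I$); compute $c=\{s_i\mid l_i(v_{\overline{x}},v_{\overline{y}})\}$; if $(q',c)\in T(q,v_{\overline{e}})$ for some $q\in Q_{now}$ output $v_{\overline{y}}$, else pick an allowed choice $c'$ and output some $v_{\overline{y}}'$ satisfying $f_r(v_{\overline{x}})\rightarrow f_{c'}(v_{\overline{x}},v_{\overline{y}}')$; update $Q_{now}$ to the successors under the used choice. $D\cdot S$ denotes feeding the outputs of $D$ as proposed outputs into shield $S$. -}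

module Defs where

open import Data.Nat using (ℕ; zero; suc; _≤_; _<_)
open import Data.Fin using (Fin)
open import Data.Bool using (Bool; true; false)
open import Data.Vec using (Vec; tabulate; lookup)
open import Data.Product using (Σ; ∃; _×_; _,_; proj₁; proj₂)
open import Data.Unit using (⊤)
open import Data.Empty using (⊥)
open import Relation.Nullary using (¬_)
open import Relation.Binary.PropositionalEquality using (_≡_; _≗_)

-- The theory T, seen through the literals l₁ … lₙ of the specification.
-- Valuations of the environment variables x̄ form the type X, those of
-- the system variables ȳ the type Y; literal lᵢ is evaluated on a pair of
-- valuations (quantifier-free literals are decidable on concrete values).

record Theory : Set₁ where
  field
    X   : Set
    Y   : Set
    n   : ℕ
    lit : Fin n → X → Y → Bool

_⇔_ : Set → Set → Set
A ⇔ B = (A → B) × (B → A)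

data LTL (A : Set) : Set where
  tt     : LTL A
  ff     : LTL A
  atom   : A → LTL A
  ¬ₗ_    : LTL A → LTL A
  _∧ₗ_   : LTL A → LTL A → LTL A
  _∨ₗ_   : LTL A → LTL A → LTL A
  ○_     : LTL A → LTL A
  _𝓤_    : LTL A → LTL A → LTL A
  _𝓡_    : LTL A → LTL A → LTL A
  □_     : LTL A → LTL A
  ◇_     : LTL A → LTL A

Sat : {A : Set} → LTL A → (ℕ → A → Bool) → ℕ → Set
Sat tt       σ i = ⊤
Sat ff       σ i = ⊥
Sat (atom a) σ i = σ i a ≡ true
Sat (¬ₗ φ)   σ i = ¬ Sat φ σ i
Sat (φ ∧ₗ ψ) σ i = Sat φ σ i × Sat ψ σ i
Sat (φ ∨ₗ ψ) σ i = Data.Sum._⊎_ (Sat φ σ i) (Sat ψ σ i)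
  where import Data.Sum
Sat (○ φ)    σ i = Sat φ σ (suc i)
Sat (φ 𝓤 ψ)  σ i = ∃ λ k → i ≤ k × Sat ψ σ k × (∀ j → i ≤ j → j < k → Sat φ σ j)
Sat (φ 𝓡 ψ)  σ i = ¬ (∃ λ k → i ≤ k × ¬ Sat ψ σ k × (∀ j → i ≤ j → j < k → ¬ Sat φ σ j))
Sat (□ φ)    σ i = ∀ k → i ≤ k → Sat φ σ k
Sat (◇ φ)    σ i = ∃ λ k → i ≤ k × Sat φ σ k

IsSafety : {A : Set} → LTL A → Set
IsSafety {A} φ =
  ∀ (σ : ℕ → A → Bool) → ¬ Sat φ σ 0 →
  ∃ λ k → ∀ (σ' : ℕ → A → Bool) → (∀ t → t < k → σ' t ≗ σ t) → ¬ Sat φ σ' 0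

module Abstraction (𝒯 : Theory) where
  open Theory 𝒯

  -- a choice c ⊆ {s₁…sₙ}, identified with a valuation of s̄
  Choice : Set
  Choice = Vec Bool n

  choiceOf : X → Y → Choice
  choiceOf x y = tabulate (λ i → lit i x y)

  f-c : Choice → X → Y → Set
  f-c c x y = ∀ i → lit i x y ≡ lookup c i

  Reaction : Set
  Reaction = Choice → Bool

  f-r : Reaction → X → Set
  f-r r x = ∀ c → (r c ≡ true → ∃ λ y → f-c c x y)
                × (r c ≡ false → ∀ y → ¬ f-c c x y)

  Valid : Reaction → Set
  Valid r = ∃ λ x → f-r r x

  ValidReaction : Set
  ValidReaction = Σ Reaction Valid

  -- valuations of the Boolean environment propositions e_r (r valid)
  ValE : Set
  ValE = ValidReaction → Bool

  Legal : ValE → Set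
  Legal e = ∃ λ ρ → e ρ ≡ true × (∀ ρ' → e ρ' ≡ true → proj₁ ρ' ≗ proj₁ ρ)

  Partition : X → ValE → Set
  Partition x e = Σ ValidReaction λ ρ →
    f-r (proj₁ ρ) x × (∀ ρ' → (e ρ' ≡ true) ⇔ (proj₁ ρ' ≗ proj₁ ρ))

  ShieldOK : ∀ {x e} → Partition x e → Choice → Y → Set
  ShieldOK {x} p c y = f-r (proj₁ (proj₁ p)) x → f-c c x y

  BTrace : Set
  BTrace = ℕ → ValE × Choice

  -- φ_B = φ_T[lᵢ ← sᵢ] ∧ □(φ^legal → ⋀_r (e_r → ⋁_{c∈r} (s̄ = c)))
  SatB : LTL (Fin n) → BTrace → Set
  SatB φ β =
    Sat φ (λ t i → lookup (proj₂ (β t)) i) 0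
    × (∀ t → Legal (proj₁ (β t)) →
         ∀ ρ → proj₁ (β t) ρ ≡ true → proj₁ ρ (proj₂ (β t)) ≡ true)

  record BoolCtrl : Set₁ where
    field
      Q  : Set
      q₀ : Q
      δ  : Q → ValE → Q
      o  : Q → ValE → Choice

  runB : (C : BoolCtrl) → (ℕ → ValE) → ℕ → BoolCtrl.Q C
  runB C es zero    = BoolCtrl.q₀ C
  runB C es (suc t) = BoolCtrl.δ C (runB C es t) (es t)

  Winning : LTL (Fin n) → BoolCtrl → Set
  Winning φ C = ∀ (es : ℕ → ValE) →
    SatB φ (λ t → es t , BoolCtrl.o C (runB C es t) (es t))

  -- Winning regions ⟨Q,I,T⟩; T q e q' c  means  (q',c) ∈ T(q,e)

  record Region : Set₁ where
    field
      Q : Set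
      I : Q → Set
      T : Q → ValE → Q → Choice → Set

  IsWinningRegion : LTL (Fin n) → Region → Set₁
  IsWinningRegion φ W =
    (∀ (es : ℕ → ValE) (qs : ℕ → Q) (cs : ℕ → Choice) → I (qs 0) →
       (∀ t → T (qs t) (es t) (qs (suc t)) (cs t)) →
       SatB φ (λ t → es t , cs t))
    × (∀ (C : BoolCtrl) → Winning φ C →
         ∃ λ (h : BoolCtrl.Q C → Q) →
           I (h (BoolCtrl.q₀ C))
           × (∀ (es : ℕ → ValE) t →
                T (h (runB C es t)) (es t) (h (runB C es (suc t)))
                  (BoolCtrl.o C (runB C es t) (es t))))
    where open Region W

  record Ctrl : Set₁ where
    field
      S    : Set
      s₀   : S
      step : S → X → S
      out  : S → X → Y

  runD : (D : Ctrl) → (ℕ → X) → ℕ → Ctrl.S D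
  runD D xs zero    = Ctrl.s₀ D
  runD D xs (suc t) = Ctrl.step D (runD D xs t) (xs t)

  outD : (D : Ctrl) → (ℕ → X) → ℕ → Y
  outD D xs t = Ctrl.out D (runD D xs t) (xs t)

  -- Shields, as relations  input sequence × proposed outputs × outputs.

  Shield₁ : BoolCtrl → (ℕ → X) → (ℕ → Y) → (ℕ → Y) → Set
  Shield₁ C xs ps ys =
    Σ (ℕ → ValE) λ es → Σ (∀ t → Partition (xs t) (es t)) λ part →
    ∀ t → let c = BoolCtrl.o C (runB C es t) (es t) in
          (ShieldOK (part t) c (ps t) → ys t ≡ ps t)
          × (¬ ShieldOK (part t) c (ps t) → ShieldOK (part t) c (ys t))

  Shield₂ : Region → (ℕ → X) → (ℕ → Y) → (ℕ → Y) → Set₁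
  Shield₂ W xs ps ys =
    Σ (ℕ → ValE) λ es → Σ (∀ t → Partition (xs t) (es t)) λ part →
    Σ (ℕ → Q → Set) λ Qnow →
    (∀ q → Qnow 0 q ⇔ I q)
    × (∀ t →
        let c = choiceOf (xs t) (ps t)
            allowed = λ c' → ∃ λ q → ∃ λ q' → Qnow t q × T q (es t) q' c'
            succ = λ c' q' → ∃ λ q → Qnow t q × T q (es t) q' c'
        in (allowed c → ys t ≡ ps t × (∀ q' → Qnow (suc t) q' ⇔ succ c q'))
         × (¬ allowed c →
              ∃ λ c' → allowed c' × ShieldOK (part t) c' (ys t)
                     × (∀ q' → Qnow (suc t) q' ⇔ succ c' q')))
    where open Region W

  TraceDC₁ : Ctrl → BoolCtrl → (ℕ → X) → (ℕ → Y) → Set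
  TraceDC₁ D C xs ys = Shield₁ C xs (outD D xs) ys

  TraceDC₁C₂ : Ctrl → BoolCtrl → Region → (ℕ → X) → (ℕ → Y) → Set₁
  TraceDC₁C₂ D C W xs ys =
    Σ (ℕ → Y) λ ps → TraceDC₁ D C xs ps × Shield₂ W xs ps ys

module Submission where

-- C₁ enforces the choices of the winning controller C_𝔹, so every output
-- it produces realises o(q, e) for the current state q of C_𝔹.  The winning
-- region is complete, so the play of C_𝔹 embeds into it; hence the choice
-- realised by C₁'s output is always allowed by C₂ from a state in Q_now,
-- and C₂ passes the output through unchanged.

open import Defs
open import Data.Nat using (ℕ; zero; suc)
open import Data.Fin using (Fin)
open import Data.Bool.Properties using (_≟_)
open import Data.Vec using (lookup)
open import Data.Vec.Properties using (tabulate∘lookup; tabulate-cong)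
open import Data.Product using (∃; _×_; _,_; proj₁; proj₂)
open import Function using (id)
open import Relation.Nullary using (¬_)
open import Relation.Nullary.Decidable using (decidable-stable)
open import Relation.Nullary.Negation using (Stable; contradiction)
open import Relation.Binary.PropositionalEquality using (_≡_; refl; trans; sym; subst)

module _ (𝒯 : Theory) where
  open Theory 𝒯
  open Abstraction 𝒯

  f-c-stable : ∀ c x y → Stable (f-c c x y)
  f-c-stable c x y ¬¬fc i =
    decidable-stable (lit i x y ≟ lookup c i) λ ¬eq → ¬¬fc λ fc → ¬eq (fc i)

  choiceOf-f-c : ∀ {c x y} → f-c c x y → choiceOf x y ≡ c
  choiceOf-f-c {c} fc = trans (tabulate-cong fc) (tabulate∘lookup c)

  shield₁-output-realises-choice :
    (C : BoolCtrl) {xs : ℕ → X} {ps ys : ℕ → Y} (s : Shield₁ C xs ps ys) → ∀ t →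
    let es = proj₁ s in
    f-c (BoolCtrl.o C (runB C es t) (es t)) (xs t) (ys t)
  -- The shield relation does not record whether the proposal was kept, so
  -- the case split on it happens under a double negation.
  shield₁-output-realises-choice C {xs} {ps} {ys} (es , part , shield) t =
    f-c-stable c (xs t) (ys t) λ ¬fc →
      let ¬ok-ys : ¬ ShieldOK (part t) c (ys t)
          ¬ok-ys ok = ¬fc (ok reaction-holds)
          ¬ok-ps : ¬ ShieldOK (part t) c (ps t)
          ¬ok-ps ok = ¬ok-ys (subst (ShieldOK (part t) c) (sym (proj₁ (shield t) ok)) ok)
      in ¬ok-ys (proj₂ (shield t) ¬ok-ps)
    where
      c : Choice
      c = BoolCtrl.o C (runB C es t) (es t)
      reaction-holds : f-r (proj₁ (proj₁ (part t))) (xs t)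
      reaction-holds = proj₁ (proj₂ (part t))

  module _ (W : Region) where
    open Region W

    Reachable : (ℕ → ValE) → (ℕ → Choice) → ℕ → Q → Set
    Reachable es cs zero    q  = I q
    Reachable es cs (suc t) q' = ∃ λ q → Reachable es cs t q × T q (es t) q' (cs t)

    embedded-run-reachable :
      (C : BoolCtrl) (h : BoolCtrl.Q C → Q) → I (h (BoolCtrl.q₀ C)) →
      (es : ℕ → ValE) →
      (∀ t → T (h (runB C es t)) (es t) (h (runB C es (suc t)))
               (BoolCtrl.o C (runB C es t) (es t))) →
      {cs : ℕ → Choice} → (∀ t → cs t ≡ BoolCtrl.o C (runB C es t) (es t)) →
      ∀ t → Reachable es cs t (h (runB C es t))
    embedded-run-reachable C h h-init es h-step cs≡o zero    = h-init
    embedded-run-reachable C h h-init es h-step cs≡o (suc t) =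
      h (runB C es t) , embedded-run-reachable C h h-init es h-step cs≡o t ,
      subst (T _ (es t) _) (sym (cs≡o t)) (h-step t)

lemma3 : (𝒯 : Theory) (φ : LTL (Fin (Theory.n 𝒯))) → IsSafety φ →
    let open Abstraction 𝒯 in
    (C : BoolCtrl) → Winning φ C →
    (W : Region) → IsWinningRegion φ W →
    (D : Ctrl) (xs : ℕ → Theory.X 𝒯) (ys : ℕ → Theory.Y 𝒯) →
    TraceDC₁ D C xs ys → TraceDC₁C₂ D C W xs ys
lemma3 𝒯 φ _ C win W (_ , complete) D xs ys trace@(es , part , _) =
  ys , trace , es , part , Qnow , (λ _ → id , id) , λ t →
    (λ _ → refl , λ _ → id , id) , λ ¬allowed → contradiction (allowed t) ¬allowed
  where
    open Abstraction 𝒯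
    open Region W
    h : BoolCtrl.Q C → Q
    h = proj₁ (complete C win)
    run : ℕ → BoolCtrl.Q C
    run = runB C es
    cs : ℕ → Choice
    cs t = choiceOf (xs t) (ys t)
    Qnow : ℕ → Q → Set
    Qnow = Reachable 𝒯 W es cs
    reachable : ∀ t → Qnow t (h (run t))
    reachable = embedded-run-reachable 𝒯 W C h (proj₁ (proj₂ (complete C win))) es
      (proj₂ (proj₂ (complete C win)) es)
      (λ t → choiceOf-f-c 𝒯 (shield₁-output-realises-choice 𝒯 C trace t))
    allowed : ∀ t → ∃ λ q → ∃ λ q' → Qnow t q × T q (es t) q' (cs t)
    allowed t with reachable (suc t)
    ... | q , q-reachable , q→next = q , h (run (suc t)) , q-reachable , q→next
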